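{- Let $\Pi_q$ be a projective plane of order $q$ and $r$ a positive integer. If a set $A$ of points contains all points of $r$ distinct lines passing through a common point $P$ (an "$r$-broom"), then $A$ percolates in $r$-neighbor line percolation.
   Context: A finite projective plane $\Pi_q$ of order $q\ge 2$ has $q^2+q+1$ points and $q^2+q+1$ lines; every line contains $q+1$ points, every point lies on $q+1$ lines, any two lines meet in exactly one point and any two points lie on exactly one line. $r$-neighbor line percolation: for a set $A$ of points let $A^0=A$ and for $s\ge1$ let $A^s=A^{s-1}\cup\{P: \exists \text{ line } l\ni P \text{ with } |l\cap A^{s-1}|\ge r\}$; $A$ percolates if $A^k$ equals the whole point set for some $k$. -}

module Defs where

open import Data.Nat using (ℕ; suc; _+_; _*_; _≤_)
open import Data.Fin using (Fin)
open import Data.Bool using (Bool; T)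
open import Data.Product using (Σ; ∃; _×_)
open import Data.Sum using (_⊎_)
open import Relation.Binary.PropositionalEquality using (_≡_)
open import Relation.Nullary using (¬_)
open import Function.Bundles using (_↔_)
open import Function.Definitions using (Injective)

-- number of points (= number of lines) of a projective plane of order q
size : ℕ → ℕ
size q = q * q + q + 1

record ProjectivePlane (q : ℕ) : Set where
  field
    order≥2  : 2 ≤ q
    incident : Fin (size q) → Fin (size q) → Bool

  Point : Set
  Point = Fin (size q)

  Line : Set
  Line = Fin (size q)

  _on_ : Point → Line → Set
  P on l = T (incident P l)

  field
    lineSize   : ∀ (l : Line) → Fin (suc q) ↔ Σ Point (λ P → P on l)
    pointDeg   : ∀ (P : Point) → Fin (suc q) ↔ Σ Line (λ l → P on l)
    joinUnique : ∀ (P Q : Point) → ¬ P ≡ Q →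
                 ∃ λ l → P on l × Q on l × (∀ m → P on m → Q on m → m ≡ l)
    meetUnique : ∀ (l m : Line) → ¬ l ≡ m →
                 ∃ λ P → P on l × P on m × (∀ Q → Q on l → Q on m → Q ≡ P)

module Percolation {q : ℕ} (Π : ProjectivePlane q) (r : ℕ) where
  open ProjectivePlane Π

  PointSet : Set₁
  PointSet = Point → Set

  -- |l ∩ S| ≥ r : there are r distinct points of l lying in S
  AtLeastOn : Line → PointSet → Set
  AtLeastOn l S = Σ (Fin r → Point) λ f →
    Injective _≡_ _≡_ f × (∀ i → f i on l × S (f i))

  step : PointSet → PointSet
  step S P = S P ⊎ ∃ λ l → P on l × AtLeastOn l S

  iter : ℕ → PointSet → PointSet
  iter 0 A = A
  iter (suc s) A = step (iter s A)

  Percolates : PointSet → Set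
  Percolates A = ∃ λ k → ∀ P → iter k A P

  ContainsBroom : PointSet → Set
  ContainsBroom A = ∃ λ (P : Point) → Σ (Fin r → Line) λ g →
    Injective _≡_ _≡_ g × (∀ i → P on g i) × (∀ i Q → Q on g i → A Q)

-- Every point Q ≠ P lies on at least two lines, at most one of which passes
-- through P, so some line m through Q misses P. The r broom lines meet m in r
-- points, pairwise distinct because two broom lines share only P, which is not
-- on m. These r points lie in A, hence Q ∈ A¹: a broom percolates in one step.
module Submission where

open import Defs
open import Data.Nat using (ℕ; suc; _≤_)
open import Data.Nat.Properties using (<⇒≤)
open import Data.Fin using (Fin; zero; suc; fromℕ<; _≟_)
open import Data.Fin.Properties using (0≢1+n)
open import Data.Bool.Properties using (T-irrelevant)
open import Data.Product using (Σ; ∃; ∃₂; _×_; _,_; proj₁; proj₂)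
open import Data.Product.Properties using (Σ-≡,≡→≡)
open import Data.Sum using (inj₁; inj₂)
open import Data.Empty using (⊥-elim)
open import Function.Bundles using (Inverse; Injection)
open import Function.Definitions using (Injective)
open import Function.Properties.Inverse using (↔⇒↣)
open import Relation.Nullary using (¬_; Dec; yes; no; contradiction)
open import Relation.Nullary.Decidable using (T?)
open import Relation.Binary.PropositionalEquality using (_≡_; _≢_; refl; sym; trans; subst)

module _ {q : ℕ} (Π : ProjectivePlane q) where
  open ProjectivePlane Π

  _on?_ : ∀ P l → Dec (P on l)
  P on? l = T? (incident P l)

  join-unique : ∀ {P Q l l′} → P ≢ Q → P on l → Q on l → P on l′ → Q on l′ → l ≡ l′
  join-unique P≢Q Pl Ql Pl′ Ql′ with joinUnique _ _ P≢Q
  ... | _ , _ , _ , unique = trans (unique _ Pl Ql) (sym (unique _ Pl′ Ql′))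

  meet-unique : ∀ {l l′ P Q} → l ≢ l′ → P on l → P on l′ → Q on l → Q on l′ → P ≡ Q
  meet-unique l≢l′ Pl Pl′ Ql Ql′ with meetUnique _ _ l≢l′
  ... | _ , _ , _ , unique = trans (unique _ Pl Pl′) (sym (unique _ Ql Ql′))

  meet : ∀ {l m} → l ≢ m → Point
  meet l≢m = proj₁ (meetUnique _ _ l≢m)

  meet-onˡ : ∀ {l m} (l≢m : l ≢ m) → meet l≢m on l
  meet-onˡ l≢m = proj₁ (proj₂ (meetUnique _ _ l≢m))

  meet-onʳ : ∀ {l m} (l≢m : l ≢ m) → meet l≢m on m
  meet-onʳ l≢m = proj₁ (proj₂ (proj₂ (meetUnique _ _ l≢m)))

  two-lines-through : ∀ Q → ∃₂ λ l l′ → l ≢ l′ × Q on l × Q on l′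
  two-lines-through Q =
    proj₁ (to zero) , proj₁ (to second) , distinct , proj₂ (to zero) , proj₂ (to second)
    where
    open Inverse (pointDeg Q) using (to)
    open Injection (↔⇒↣ (pointDeg Q)) using (injective)

    second′ : ∀ {n} → 1 ≤ n → Fin (suc n)
    second′ {suc _} _ = suc zero

    second : Fin (suc q)
    second = second′ (<⇒≤ order≥2)

    zero≢second : ∀ {n} (1≤n : 1 ≤ n) → zero ≢ second′ 1≤n
    zero≢second {suc _} _ = 0≢1+n

    distinct : proj₁ (to zero) ≢ proj₁ (to second)
    distinct e = zero≢second (<⇒≤ order≥2) (injective (Σ-≡,≡→≡ (e , T-irrelevant _ _)))

  line-avoiding : ∀ {P Q} → Q ≢ P → ∃ λ m → Q on m × ¬ P on m
  line-avoiding {P} {Q} Q≢P with two-lines-through Q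
  ... | l , l′ , l≢l′ , Ql , Ql′ with P on? l | P on? l′
  ...   | no  P∉l | _       = l , Ql , P∉l
  ...   | yes _   | no P∉l′ = l′ , Ql′ , P∉l′
  ...   | yes Pl  | yes Pl′ = contradiction (join-unique Q≢P Ql Pl Ql′ Pl′) l≢l′

  broom-transversal : ∀ {r P m} (g : Fin r → Line) → Injective _≡_ _≡_ g →
                      (∀ i → P on g i) → ¬ P on m →
                      Σ (Fin r → Point) λ f → Injective _≡_ _≡_ f × (∀ i → f i on m × f i on g i)
  broom-transversal {P = P} {m} g g-injective P∈g P∉m =
    f , f-injective , λ i → meet-onʳ (g≢m i) , meet-onˡ (g≢m i)
    where
    g≢m : ∀ i → g i ≢ m
    g≢m i e = P∉m (subst (P on_) e (P∈g i))

    f : Fin _ → Point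
    f i = meet (g≢m i)

    f-injective : Injective _≡_ _≡_ f
    f-injective {i} {j} fi≡fj with i ≟ j
    ... | yes i≡j = i≡j
    ... | no  i≢j = ⊥-elim (P∉m (subst (_on m) fi≡P (meet-onʳ (g≢m i))))
      where
      fi≡P : f i ≡ P
      fi≡P = meet-unique (λ e → i≢j (g-injective e))
               (meet-onˡ (g≢m i)) (subst (_on g j) (sym fi≡fj) (meet-onˡ (g≢m j)))
               (P∈g i) (P∈g j)

module _ {q : ℕ} (Π : ProjectivePlane q) (r : ℕ) where
  open ProjectivePlane Π
  open Percolation Π r

  broom-covers-in-one-step : 1 ≤ r → (A : PointSet) → ContainsBroom A → ∀ Q → step A Q
  broom-covers-in-one-step 1≤r A (P , g , g-injective , P∈g , g⊆A) Q with Q ≟ P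
  ... | yes refl = inj₁ (g⊆A i₀ P (P∈g i₀))
    where
    i₀ : Fin r
    i₀ = fromℕ< 1≤r
  ... | no Q≢P with line-avoiding Π Q≢P
  ...   | m , Q∈m , P∉m with broom-transversal Π g g-injective P∈g P∉m
  ...     | f , f-injective , f∈m∩g = inj₂ (m , Q∈m , f , f-injective , λ i →
              proj₁ (f∈m∩g i) , g⊆A i (f i) (proj₂ (f∈m∩g i)))

proposition3 : ∀ (q : ℕ) (Π : ProjectivePlane q) (r : ℕ) → 1 ≤ r →
               (A : ProjectivePlane.Point Π → Set) →
               Percolation.ContainsBroom Π r A → Percolation.Percolates Π r A
proposition3 q Π r 1≤r A broom = 1 , broom-covers-in-one-step Π r 1≤r A broom
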